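{- For any instance $I=(S,C,T,\mathbf p,\mathbf c)$ of the DFEP, $sepcost^*(I)\le OPT_E(I)$ and $totcost^*(I)\le OPT_W(I)$.
   Context: An instance of the DFEP is $I=(S,C,T,\mathbf p,\mathbf c)$: $S$ a finite set of objects; $C$ a partition of $S$ into classes; $T$ a finite set of tests, each a function $t:S\to\{1,\dots,\ell\}$, complete (any two distinct objects are distinguished by some test); $\mathbf p$ a probability distribution on $S$; $c(t)\in\mathbb N^+$. Let $S^i_t=\{s:t(s)=i\}$. A decision tree for $I$ is a leaf labelled with a class if all objects lie in one class; otherwise a root labelled by a test $t$ whose children are decision trees for the nonempty $S^i_t$. $cost(D,s)$ is the total cost of tests on the root-to-leaf path followed by $s$; $OPT_E(I)=\min_D\sum_s p(s)cost(D,s)$ and $OPT_W(I)=\min_D\max_s cost(D,s)$. For $G\subseteq S$, $P(G)$ is the number of unordered pairs of objects of $G$ in different classes. For a test $t$, $S^*_t$ is one of $S^1_t,\dots,S^\ell_t$ maximizing $P$ (ties broken arbitrarily) and $\sigma(t)=S\setminus S^*_t$. A test $t$ covers a pair $\{x,y\}$ (of objects in different classes) if $x\in\sigma(t)$ or $y\in\sigma(t)$; a sequence of tests covers a pair if some test in it does. For a sequence $\mathbf t=t_1,\dots,t_q$ of tests and an object $x$: if $x\in\sigma(t_j)$ for some $j<q$, let $i(x)=\min\{j:x\in\sigma(t_j)\}$, otherwise $i(x)=q$; $sepcost(I,\mathbf t,x)=\sum_{j=1}^{i(x)}c(t_j)$, $sepcost(I,\mathbf t)=\sum_{s\in S}p(s)\,sepcost(I,\mathbf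 t,s)$ and $totcost(I,\mathbf t)=\sum_{j=1}^q c(t_j)$. $sepcost^*(I)$ (resp. $totcost^*(I)$) is the minimum of $sepcost(I,\mathbf t)$ (resp. $totcost(I,\mathbf t)$) over sequences $\mathbf t$ of tests of $T$ covering all pairs of $S$.
   Formalization: The probability distribution $\mathbf p$ on the objects of $S$ takes rational values. -}

module Defs where

open import Data.Nat as ℕ using (ℕ; zero; suc)
open import Data.Integer using (+_)
open import Data.Rational as ℚ using (ℚ; 0ℚ; 1ℚ; _/_)
open import Data.Fin using (Fin; zero; suc; _<_)
open import Data.Fin.Properties using (_≟_)
open import Data.Bool using (Bool; true; false; _∧_; if_then_else_; not)
open import Data.List using (List; []; _∷_)
open import Data.List.Relation.Unary.Any using (Any)
open import Data.Product using (Σ; ∃; _×_; _,_)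
open import Data.Empty using (⊥)
open import Relation.Nullary using (¬_)
open import Relation.Nullary.Decidable using (⌊_⌋)
open import Relation.Binary.PropositionalEquality using (_≡_; _≢_)

sumℕ : ∀ n → (Fin n → ℕ) → ℕ
sumℕ zero    f = 0
sumℕ (suc n) f = f zero ℕ.+ sumℕ n (λ i → f (suc i))

sumℚ : ∀ n → (Fin n → ℚ) → ℚ
sumℚ zero    f = 0ℚ
sumℚ (suc n) f = f zero ℚ.+ sumℚ n (λ i → f (suc i))

maxℕ : ∀ n → (Fin n → ℕ) → ℕ
maxℕ zero    f = 0
maxℕ (suc n) f = f zero ℕ.⊔ maxℕ n (λ i → f (suc i))

ℕ→ℚ : ℕ → ℚ
ℕ→ℚ k = (+ k) / 1

-- Objects S = Fin n, classes are labels Fin k (the partition C is the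
-- partition of S by the label cls), tests are indexed by Fin m, each test
-- has outcomes Fin ℓ (standing for {1,…,ℓ}).
record Instance : Set where
  field
    n k m ℓ  : ℕ
    cls      : Fin n → Fin k
    test     : Fin m → Fin n → Fin ℓ
    complete : ∀ (x y : Fin n) → x ≢ y → ∃ λ t → test t x ≢ test t y
    p        : Fin n → ℚ
    p-nonneg : ∀ s → 0ℚ ℚ.≤ p s
    p-sum    : sumℚ n p ≡ 1ℚ
    c        : Fin m → ℕ
    c-pos    : ∀ t → 1 ℕ.≤ c t

module _ (I : Instance) where
  open Instance I

  Subset : Set
  Subset = Fin n → Bool

  sameCls : Fin n → Fin n → Bool
  sameCls x y = ⌊ cls x ≟ cls y ⌋

  branch : Fin m → Fin ℓ → Subset
  branch t i s = ⌊ test t s ≟ i ⌋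

  P : Subset → ℕ
  P G = sumℕ n λ x → sumℕ n λ y →
          if ⌊ Data.Fin._<?_ x y ⌋ ∧ G x ∧ G y ∧ not (sameCls x y) then 1 else 0

  IsStarChoice : (Fin m → Fin ℓ) → Set
  IsStarChoice star = ∀ t i → P (branch t i) ℕ.≤ P (branch t (star t))

  module _ (star : Fin m → Fin ℓ) where

    inσ : Fin m → Fin n → Bool
    inσ t x = not ⌊ test t x ≟ star t ⌋

    CoversAll : List (Fin m) → Set
    CoversAll ts = ∀ (x y : Fin n) → cls x ≢ cls y →
                   Any (λ t → inσ t x ≡ true ⊎' inσ t y ≡ true) ts
      where
        open import Data.Sum using () renaming (_⊎_ to _⊎'_)

    sepcostObj : List (Fin m) → Fin n → ℕ
    sepcostObj []       x = 0
    sepcostObj (t ∷ ts) x = c t ℕ.+ (if inσ t x then 0 else sepcostObj ts x)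

    sepcost : List (Fin m) → ℚ
    sepcost ts = sumℚ n λ s → p s ℚ.* ℕ→ℚ (sepcostObj ts s)

    totcost : List (Fin m) → ℕ
    totcost []       = 0
    totcost (t ∷ ts) = c t ℕ.+ totcost ts

  data Tree : Set where
    leaf : Fin k → Tree
    node : Fin m → (Fin ℓ → Tree) → Tree

  AllIn : Subset → Fin k → Set
  AllIn G c' = ∀ s → G s ≡ true → cls s ≡ c'

  Homogeneous : Subset → Set
  Homogeneous G = ∃ λ c' → AllIn G c'

  -- A leaf is allowed
  -- only if all objects of G lie in its class; otherwise the root is a test
  -- whose child for outcome i is a decision tree for G ∩ S^i_t.
  -- (Children for empty outcomes are forced to be irrelevant leaves.)
  IsDT : Subset → Tree → Set
  IsDT G (leaf c')   = AllIn G c'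
  IsDT G (node t ch) = ¬ Homogeneous G × (∀ i → IsDT (λ s → G s ∧ branch t i s) (ch i))

  IsDecisionTree : Tree → Set
  IsDecisionTree = IsDT (λ _ → true)

  cost : Tree → Fin n → ℕ
  cost (leaf _)    s = 0
  cost (node t ch) s = c t ℕ.+ cost (ch (test t s)) s

  expCost : Tree → ℚ
  expCost D = sumℚ n λ s → p s ℚ.* ℕ→ℚ (cost D s)

  worstCost : Tree → ℕ
  worstCost D = maxℕ n (cost D)

module Submission where

-- Both bounds are witnessed by one sequence of tests read off an arbitrary
-- decision tree D: its "star path", which starts at the root and, at every
-- node labelled by a test t, descends into the child for the outcome S*_t.
--
--  * Covering.  If x, y lie in different classes, D cannot put them in one
--    leaf.  As long as neither lies in σ(t) for the tests t passed so far, both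
--    follow the star path, so some test on it has x or y in its σ-set.
--  * Expected cost.  An object x follows the star path until the first test
--    t with x ∈ σ(t), so sepcost(path, x) ≤ cost(D, x); weighting by p(x)
--    gives sepcost ≤ expected cost of D.
--  * Worst-case cost.  Every inner node of D separates a nonempty set, so
--    the full star path is (a prefix of) the root-to-leaf path of some object,
--    whence totcost ≤ max_x cost(D, x).
--
-- None of this uses that S*_t maximizes P: the bounds hold for any choice
-- of one outcome per test.

open import Defs
open import Data.Nat using (ℕ) renaming (_≤_ to _≤ℕ_)
open import Data.Rational using (ℚ) renaming (_≤_ to _≤ℚ_)
open import Data.Fin using (Fin)
open import Data.List using (List)
open import Data.Product using (Σ; _×_)

open import Data.Nat as ℕ using (zero; suc; z≤n)
import Data.Nat.Properties as ℕP
import Data.Rational as ℚ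
import Data.Rational.Properties as ℚP
import Data.Integer as ℤ
import Data.Integer.Properties as ℤP
open import Data.Integer using (+_)
import Data.Nat.Coprimality as Coprimality
open import Data.Fin using (zero; suc)
import Data.Fin.Properties as FinP
open import Data.Bool using (Bool; true; false; _∧_)
open import Data.List using ([]; _∷_)
open import Data.List.Relation.Unary.Any using (Any; here; there)
open import Data.Product using (_,_; ∃)
open import Data.Sum using (_⊎_; inj₁; inj₂)
open import Data.Empty using (⊥-elim)
open import Relation.Nullary using (yes; no; ¬_)
open import Relation.Binary.PropositionalEquality

ℕ→ℚ-asFraction : ∀ a →
  ℕ→ℚ a ≡ ℚ.mkℚ (+ a) 0 (Coprimality.sym (Coprimality.1-coprimeTo a))
ℕ→ℚ-asFraction a = ℚP.normalize-coprime (Coprimality.sym (Coprimality.1-coprimeTo a))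

ℕ→ℚ-mono : ∀ {a b} → a ≤ℕ b → ℕ→ℚ a ≤ℚ ℕ→ℚ b
ℕ→ℚ-mono {a} {b} a≤b rewrite ℕ→ℚ-asFraction a | ℕ→ℚ-asFraction b =
  ℚ.*≤* (subst₂ ℤ._≤_ (sym (ℤP.*-identityʳ (+ a))) (sym (ℤP.*-identityʳ (+ b)))
                       (ℤ.+≤+ a≤b))

sumℚ-mono : ∀ n (f g : Fin n → ℚ) → (∀ i → f i ≤ℚ g i) → sumℚ n f ≤ℚ sumℚ n g
sumℚ-mono zero    f g f≤g = ℚP.≤-refl
sumℚ-mono (suc n) f g f≤g =
  ℚP.+-mono-≤ (f≤g zero) (sumℚ-mono n _ _ (λ i → f≤g (suc i)))

expectation-mono : ∀ n (w : Fin n → ℚ) → (∀ i → ℚ.0ℚ ≤ℚ w i) →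
  (f g : Fin n → ℕ) → (∀ i → f i ≤ℕ g i) →
  sumℚ n (λ i → w i ℚ.* ℕ→ℚ (f i)) ≤ℚ sumℚ n (λ i → w i ℚ.* ℕ→ℚ (g i))
expectation-mono n w w≥0 f g f≤g = sumℚ-mono n _ _ λ i →
  ℚP.*-monoˡ-≤-nonNeg (w i) {{ℚ.nonNegative (w≥0 i)}} (ℕ→ℚ-mono (f≤g i))

maxℕ-ub : ∀ n (f : Fin n → ℕ) i → f i ≤ℕ maxℕ n f
maxℕ-ub (suc n) f zero    = ℕP.m≤m⊔n _ _
maxℕ-ub (suc n) f (suc i) =
  ℕP.≤-trans (maxℕ-ub n (λ j → f (suc j)) i) (ℕP.m≤n⊔m _ _)

∧-true : ∀ {a b : Bool} → a ∧ b ≡ true → a ≡ true × b ≡ true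
∧-true {true} {true} refl = refl , refl

module StarPath (I : Instance) (star : Fin (Instance.m I) → Fin (Instance.ℓ I)) where
  open Instance I

  -- S is nonempty, since its probabilities sum to 1.
  someObject : Fin n
  someObject = pick n p-sum
    where
    pick : ∀ n {q : Fin n → ℚ} → sumℚ n q ≡ ℚ.1ℚ → Fin n
    pick zero    ()
    pick (suc n) _ = zero

  inhabited : ∀ G → ¬ Homogeneous I G → ∃ λ x → G x ≡ true
  inhabited G inhomogeneous with FinP.any? (λ s → G s Data.Bool.≟ true)
  ... | yes member = member
  ... | no  empty  =
    ⊥-elim (inhomogeneous (cls someObject , λ s gs → ⊥-elim (empty (s , gs))))

  inBranch⇒answer : ∀ t i x → branch I t i x ≡ true → test t x ≡ i
  inBranch⇒answer t i x inB with test t x FinP.≟ i | inB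
  ... | yes answer | _ = answer

  answer⇒inBranch : ∀ t i x → test t x ≡ i → branch I t i x ≡ true
  answer⇒inBranch t i x answer with test t x FinP.≟ i
  ... | yes _      = refl
  ... | no  differ = ⊥-elim (differ answer)

  notInσ⇒star : ∀ t x → inσ I star t x ≡ false → test t x ≡ star t
  notInσ⇒star t x notInσ with test t x FinP.≟ star t | notInσ
  ... | yes answer | _ = answer

  starPath : Tree I → List (Fin m)
  starPath (leaf _)    = []
  starPath (node t ch) = t ∷ starPath (ch (star t))

  Covers : Fin n → Fin n → Fin m → Set
  Covers x y t = inσ I star t x ≡ true ⊎ inσ I star t y ≡ true

  starPath-covers : ∀ {G} D → IsDT I G D → ∀ x y → G x ≡ true → G y ≡ true →
                    cls x ≢ cls y → Any (Covers x y) (starPath D)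
  starPath-covers (leaf _) allIn x y gx gy differ =
    ⊥-elim (differ (trans (allIn x gx) (sym (allIn y gy))))
  starPath-covers (node t ch) (_ , children) x y gx gy differ
    with inσ I star t x in xσ | inσ I star t y in yσ
  ... | true  | _     = here (inj₁ xσ)
  ... | false | true  = here (inj₂ yσ)
  ... | false | false =
    there (starPath-covers (ch (star t)) (children (star t)) x y
             (cong₂ _∧_ gx (inS* x xσ)) (cong₂ _∧_ gy (inS* y yσ)) differ)
    where
    inS* : ∀ z → inσ I star t z ≡ false → branch I t (star t) z ≡ true
    inS* z notInσ = answer⇒inBranch t (star t) z (notInσ⇒star t z notInσ)

  sepcost≤cost : ∀ D x → sepcostObj I star (starPath D) x ≤ℕ cost I D x
  sepcost≤cost (leaf _)    x = z≤n
  sepcost≤cost (node t ch) x with inσ I star t x in xσ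
  ... | true  = ℕP.+-monoʳ-≤ (c t) z≤n
  ... | false rewrite notInσ⇒star t x xσ =
    ℕP.+-monoʳ-≤ (c t) (sepcost≤cost (ch (star t)) x)

  totcost-realised : ∀ {G} D → IsDT I G D →
    totcost I star (starPath D) ≡ 0
    ⊎ ∃ λ x → G x ≡ true × totcost I star (starPath D) ≤ℕ cost I D x
  totcost-realised (leaf _) _ = inj₁ refl
  totcost-realised {G} (node t ch) (inhomogeneous , children)
    with totcost-realised (ch (star t)) (children (star t))
  ... | inj₁ restFree =
    let x , gx = inhabited G inhomogeneous
    in inj₂ (x , gx , ℕP.+-monoʳ-≤ (c t)
                        (subst (_≤ℕ cost I (ch (test t x)) x) (sym restFree) z≤n))
  ... | inj₂ (x , gS*x , restPaid) =
    let gx , inS* = ∧-true gS*x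
        answer    = inBranch⇒answer t (star t) x inS*
        rest      = totcost I star (starPath (ch (star t)))
    in inj₂ (x , gx , subst (λ i → c t ℕ.+ rest ≤ℕ c t ℕ.+ cost I (ch i) x) (sym answer)
                            (ℕP.+-monoʳ-≤ (c t) restPaid))

  totcost≤worstCost : ∀ D → IsDecisionTree I D →
                      totcost I star (starPath D) ≤ℕ worstCost I D
  totcost≤worstCost D isDT with totcost-realised D isDT
  ... | inj₁ free = subst (_≤ℕ _) (sym free) z≤n
  ... | inj₂ (x , _ , paid) = ℕP.≤-trans paid (maxℕ-ub n (cost I D) x)

theorem1 : (I : Instance) (star : Fin (Instance.m I) → Fin (Instance.ℓ I)) →
    IsStarChoice I star →
    ((D : Tree I) → IsDecisionTree I D →
      Σ (List (Fin (Instance.m I))) (λ ts →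
        CoversAll I star ts × sepcost I star ts ≤ℚ expCost I D))
    ×
    ((D : Tree I) → IsDecisionTree I D →
      Σ (List (Fin (Instance.m I))) (λ ts →
        CoversAll I star ts × totcost I star ts ≤ℕ worstCost I D))
theorem1 I star _ =
  (λ D isDT → starPath D , covers D isDT ,
     expectation-mono n p p-nonneg _ _ (sepcost≤cost D)) ,
  (λ D isDT → starPath D , covers D isDT , totcost≤worstCost D isDT)
  where
  open Instance I
  open StarPath I star

  covers : ∀ D → IsDecisionTree I D → CoversAll I star (starPath D)
  covers D isDT x y = starPath-covers D isDT x y refl refl
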